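{- Let $G$ be a graph, $k$ a positive integer, and $V_1,\dots,V_t$ a partition of $V(G)$ into types, each designated a clique type or an independent type. If $G$ has a star coloring using at most $k$ colors, then the system of constraints (C0)–(C7) below in the integer variables $n_A$, $A\subseteq\{1,\dots,t\}$, has a feasible (integer) assignment. (C0) $n_A=0$ for every $A$ containing two indices $i,j$ with $V_j\in adj(V_i)$ (such subset types are discarded). (C1) $\sum_{A\subseteq[t]} n_A\le k$. (C2) For each clique type $V_i$: $\sum_{A\ni i} n_A=|V_i|$. (C3) For each independent type $V_i$: $1\le \sum_{A\ni i} n_A\le \min\{k,|V_i|\}$. (C4) For every four distinct indices $i_1,i_2,i_3,i_4$ with $V_{i_1},V_{i_3}\in adj(V_{i_2})$ and $V_{i_4}\in adj(V_{i_3})$: if $\sum_{A\ni i_1,i_3} n_A\ge 1$ then $\sum_{B\ni i_2,i_4} n_B=0$. (C5) For every three distinct indices $i_1,i_2,i_3$ with $V_{i_1}$ an independent type and $V_{i_2},V_{i_3}\in adj(V_{i_1})$: if $\sum_{A\ni i_1} n_A<|V_{i_1}|$ then $\sum_{B\ni i_2,i_3} n_B=0$. (C6) For every two distinct independent types $V_{i_1},V_{i_2}$ with $V_{i_1}\in adj(V_{i_2})$: if $\sum_{A\ni i_1} n_A<|V_{i_1}|$ then $\sum_{B\ni i_2} n_B=|V_{i_2}|$, and if $\sum_{A\ni i_2} n_A<|V_{i_2}|$ then $\sum_{B\ni i_1} n_B=|V_{i_1}|$. (C7) $n_A\ge 0$ for all $A\subseteq[t]$.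
   Context: A star coloring of $G$ is a map $f:V(G)\to\{1,\dots,k\}$ that is a proper coloring and such that every path on four vertices receives at least three distinct colors. Two vertices $u,v$ have the same type if $N(u)\setminus\{v\}=N(v)\setminus\{u\}$; $V_1,\dots,V_t$ is a partition of $V(G)$ into sets whose vertices pairwise have the same type, so each $V_i$ induces either a clique (clique type) or an independent set (independent type), and for distinct $i,j$ either every vertex of $V_i$ is adjacent to every vertex of $V_j$ or none is. $adj(V_i)$ denotes the set of types $V_j$ ($j\ne i$) all of whose vertices are adjacent to all vertices of $V_i$. $[t]=\{1,\dots,t\}$, and sums $\sum_{A\ni i}$ range over subsets $A\subseteq[t]$ containing $i$. Intuitively $n_A$ is the number of colors used in every type $V_i$ with $i\in A$ and in no type $V_j$ with $j\notin A$. -}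

module Defs where

open import Data.Nat as ℕ using (ℕ; zero; suc; _⊓_)
open import Data.Integer as ℤ using (ℤ; +_; 0ℤ)
open import Data.Bool using (Bool; true; false; if_then_else_; _∧_)
open import Data.Fin using (Fin)
open import Data.Fin.Properties using (_≟_)
open import Data.Fin.Subset using (Subset)
open import Data.Vec using (Vec; []; _∷_; lookup)
open import Data.List as List using (List; []; _∷_; length; filter; deduplicate; allFin; map; _++_)
open import Data.Product using (_×_)
open import Relation.Binary.PropositionalEquality using (_≡_; _≢_)

Adjacency : ℕ → Set
Adjacency n = Fin n → Fin n → Bool

IsSimpleGraph : ∀ {n} → Adjacency n → Set
IsSimpleGraph {n} E =
  (∀ (u v : Fin n) → E u v ≡ E v u) × (∀ (u : Fin n) → E u u ≡ false)

numColours : ∀ {n k} → (Fin n → Fin k) → List (Fin n) → ℕ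
numColours f vs = length (deduplicate _≟_ (map f vs))

IsProperColouring : ∀ {n k} → Adjacency n → (Fin n → Fin k) → Set
IsProperColouring {n} E f = ∀ (u v : Fin n) → E u v ≡ true → f u ≢ f v

IsP4 : ∀ {n} → Adjacency n → Fin n → Fin n → Fin n → Fin n → Set
IsP4 E a b c d =
  (a ≢ b) × (a ≢ c) × (a ≢ d) × (b ≢ c) × (b ≢ d) × (c ≢ d) ×
  (E a b ≡ true) × (E b c ≡ true) × (E c d ≡ true)

IsStarColouring : ∀ {n k} → Adjacency n → (Fin n → Fin k) → Set
IsStarColouring {n} E f =
  IsProperColouring E f ×
  (∀ (a b c d : Fin n) → IsP4 E a b c d →
     3 ℕ.≤ numColours f (a ∷ b ∷ c ∷ d ∷ []))

-- Partitions into types.  τ v = i means v ∈ V_i.  cl i = true means V_i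
-- is designated a clique type, false an independent type.

card : ∀ {n t} → (Fin n → Fin t) → Fin t → ℕ
card {n} τ i = length (filter (λ v → τ v ≟ i) (allFin n))

IsTypePartition : ∀ {n t} → Adjacency n → (Fin n → Fin t) → (Fin t → Bool) → Set
IsTypePartition {n} {t} E τ cl =
  (∀ (i : Fin t) → 1 ℕ.≤ card τ i) ×
  -- vertices in the same part have the same type: N(u)∖{v} = N(v)∖{u}
  (∀ (u v w : Fin n) → τ u ≡ τ v → w ≢ u → w ≢ v → E u w ≡ E v w) ×
  (∀ (u v : Fin n) → τ u ≡ τ v → u ≢ v → E u v ≡ cl (τ u))

TAdj : ∀ {n t} → Adjacency n → (Fin n → Fin t) → Fin t → Fin t → Set
TAdj {n} E τ i j =
  (i ≢ j) × (∀ (u v : Fin n) → τ u ≡ i → τ v ≡ j → E u v ≡ true)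

allSubsets : (t : ℕ) → List (Subset t)
allSubsets zero = [] ∷ []
allSubsets (suc t) = map (true ∷_) (allSubsets t) ++ map (false ∷_) (allSubsets t)

sumℤ : List ℤ → ℤ
sumℤ = List.foldr ℤ._+_ 0ℤ

sumWhere : ∀ {t} → (Subset t → Bool) → (Subset t → ℤ) → ℤ
sumWhere {t} P x = sumℤ (map (λ A → if P A then x A else 0ℤ) (allSubsets t))

sumAll : ∀ {t} → (Subset t → ℤ) → ℤ
sumAll x = sumWhere (λ _ → true) x

sum∋ : ∀ {t} → Fin t → (Subset t → ℤ) → ℤ
sum∋ i x = sumWhere (λ A → lookup A i) x

sum∋₂ : ∀ {t} → Fin t → Fin t → (Subset t → ℤ) → ℤ
sum∋₂ i j x = sumWhere (λ A → lookup A i ∧ lookup A j) x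

Feasible : ∀ {n t} → Adjacency n → (Fin n → Fin t) → (Fin t → Bool) → ℕ →
           (Subset t → ℤ) → Set
Feasible {n} {t} E τ cl k x =
  (∀ (A : Subset t) (i j : Fin t) → TAdj E τ i j →
     lookup A i ≡ true → lookup A j ≡ true → x A ≡ 0ℤ) ×
  (sumAll x ℤ.≤ + k) ×
  (∀ (i : Fin t) → cl i ≡ true → sum∋ i x ≡ + card τ i) ×
  (∀ (i : Fin t) → cl i ≡ false →
     (+ 1 ℤ.≤ sum∋ i x) × (sum∋ i x ℤ.≤ + (k ⊓ card τ i))) ×
  (∀ (i₁ i₂ i₃ i₄ : Fin t) →
     i₁ ≢ i₂ → i₁ ≢ i₃ → i₁ ≢ i₄ → i₂ ≢ i₃ → i₂ ≢ i₄ → i₃ ≢ i₄ →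
     TAdj E τ i₂ i₁ → TAdj E τ i₂ i₃ → TAdj E τ i₃ i₄ →
     + 1 ℤ.≤ sum∋₂ i₁ i₃ x → sum∋₂ i₂ i₄ x ≡ 0ℤ) ×
  (∀ (i₁ i₂ i₃ : Fin t) → i₁ ≢ i₂ → i₁ ≢ i₃ → i₂ ≢ i₃ →
     cl i₁ ≡ false → TAdj E τ i₁ i₂ → TAdj E τ i₁ i₃ →
     sum∋ i₁ x ℤ.< + card τ i₁ → sum∋₂ i₂ i₃ x ≡ 0ℤ) ×
  (∀ (i₁ i₂ : Fin t) → i₁ ≢ i₂ → cl i₁ ≡ false → cl i₂ ≡ false →
     TAdj E τ i₂ i₁ →
     (sum∋ i₁ x ℤ.< + card τ i₁ → sum∋ i₂ x ≡ + card τ i₂) ×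
     (sum∋ i₂ x ℤ.< + card τ i₂ → sum∋ i₁ x ≡ + card τ i₁)) ×
  (∀ (A : Subset t) → 0ℤ ℤ.≤ x A)

-- For a star colouring f with colours Fin k, let the support of a colour c be the
-- set of types V_i on which c occurs, and let n_A be the number of colours with
-- support A.  Then ∑_{A ∋ i} n_A counts the colours on V_i, ∑_{A ∋ i,j} n_A the
-- colours shared by V_i and V_j, and ∑_A n_A = k.  Each constraint is then a
-- property of star colourings: adjacent vertices get different colours (C0, C2);
-- at most |V_i| and at least one colour lie on V_i (C3); fewer than |V_i| colours
-- on an independent type V_i means two vertices of V_i share a colour; and every
-- violation of (C4)–(C6) exhibits a path on four vertices coloured a b a b.
module Submission where

open import Defs
open import Data.Nat using (ℕ; _≤_)
open import Data.Integer using (ℤ)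
open import Data.Bool using (Bool)
open import Data.Fin using (Fin)
open import Data.Fin.Subset using (Subset)
open import Data.Product using (Σ; _×_)

import Data.Bool as Bool
open import Data.Bool using (true; false; if_then_else_; _∨_; _∧_)
open import Data.Bool.Properties using (if-eta; if-float)
open import Data.Empty using (⊥; ⊥-elim)
open import Data.Fin using (zero; suc)
open import Data.Fin.Properties using (_≟_; any?; suc-injective)
open import Data.Integer as ℤ using (+_; 0ℤ)
open import Data.Integer.Properties using (drop‿+≤+; drop‿+<+; ≤-reflexive)
open import Data.List as List using (List; []; _∷_; map; _++_; length; filter; deduplicate; tabulate)
open import Data.List.Properties using (map-++; map-∘; map-cong)
open import Data.Nat using (zero; suc; _+_; _<_; _⊓_; s≤s; z≤n)
open import Data.Nat.ListAction using () renaming (sum to sumᴸ)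
open import Data.Nat.ListAction.Properties using () renaming (sum-++ to sumᴸ-++)
import Data.Nat.Properties as ℕ
open import Algebra.Properties.CommutativeMonoid.Sum ℕ.+-0-commutativeMonoid
  using (sum-syntax; sum-cong-≗; sum-replicate-zero; ∑-distrib-+)
open import Data.Product using (∃; _,_; proj₁; proj₂)
open import Data.Sum using (_⊎_; inj₁; inj₂)
open import Data.Vec using ([]; _∷_; lookup)
open import Data.Vec.Properties using (≡-dec; lookup∘tabulate)
import Data.Vec as Vec
open import Function using (_∘_)
open import Level using (0ℓ)
open import Relation.Binary.PropositionalEquality
open import Relation.Nullary using (Dec; yes; no; does; ¬_; _×-dec_)
open import Relation.Nullary.Decidable using (dec-false; dec-true; dec-no)
open import Relation.Unary using (Pred; Decidable)

count : ∀ {m} → (Fin m → Bool) → ℕ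
count {m} p = ∑[ c < m ] (if p c then 1 else 0)

count-cong : ∀ {m} {p q : Fin m → Bool} → p ≗ q → count p ≡ count q
count-cong p≗q = sum-cong-≗ (λ c → cong (if_then 1 else 0) (p≗q c))

count-≤ : ∀ {m} (p : Fin m → Bool) → count p ≤ m
count-≤ {zero} p = z≤n
count-≤ {suc m} p with p zero
... | true = s≤s (count-≤ (p ∘ suc))
... | false = ℕ.m≤n⇒m≤1+n (count-≤ (p ∘ suc))

count-all-true : ∀ m → count {m} (λ _ → true) ≡ m
count-all-true zero = refl
count-all-true (suc m) = cong suc (count-all-true m)

count-all-false : ∀ {m} {p : Fin m → Bool} → (∀ c → p c ≡ false) → count p ≡ 0
count-all-false {m} p≡false =
  trans (sum-cong-≗ (λ c → cong (if_then 1 else 0) (p≡false c))) (sum-replicate-zero m)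

count-≥1 : ∀ {m} {p : Fin m → Bool} (c : Fin m) → p c ≡ true → 1 ≤ count p
count-≥1 zero pc rewrite pc = s≤s z≤n
count-≥1 {p = p} (suc c) pc = ℕ.≤-trans (count-≥1 c pc) (ℕ.m≤n+m _ (if p zero then 1 else 0))

count-insert : ∀ {k} (a : Fin k) (q : Fin k → Bool) →
  count (λ c → does (a ≟ c) ∨ q c) ≡ (if q a then count q else suc (count q))
count-insert zero q with q zero
... | true = refl
... | false = refl
count-insert (suc a) q with q (suc a) | count-insert a (q ∘ suc)
... | true | eq = cong (_+_ (if q zero then 1 else 0)) eq
... | false | eq = trans (cong (_+_ (if q zero then 1 else 0)) eq) (ℕ.+-suc _ _)

module _ {m ℓ} {P : Pred (Fin m) ℓ} (P? : Decidable P) where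

  count-none : (∀ c → ¬ P c) → count (does ∘ P?) ≡ 0
  count-none ¬P = count-all-false (λ c → dec-false (P? c) (¬P c))

  count-some : ∀ {c} → P c → 1 ≤ count (does ∘ P?)
  count-some {c} Pc = count-≥1 c (dec-true (P? c) Pc)

  count-witness : 1 ≤ count (does ∘ P?) → ∃ P
  count-witness 1≤count with any? P?
  ... | yes ∃P = ∃P
  ... | no ¬∃P = ⊥-elim (ℕ.<⇒≢ 1≤count (sym (count-none (λ c Pc → ¬∃P (c , Pc)))))

length-filter-tabulate : ∀ {m ℓ} {A : Set} {P : Pred A ℓ} (P? : Decidable P) (g : Fin m → A) →
  length (filter P? (tabulate g)) ≡ count (does ∘ P? ∘ g)
length-filter-tabulate {zero} P? g = refl
length-filter-tabulate {suc m} P? g with does (P? (g zero))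
... | true = cong suc (length-filter-tabulate P? (g ∘ suc))
... | false = length-filter-tabulate P? (g ∘ suc)

from-does : ∀ {a} {A : Set a} (a? : Dec A) → does a? ≡ true → A
from-does (yes a) _ = a

Image : ∀ {n k ℓ} → Pred (Fin n) ℓ → (Fin n → Fin k) → Pred (Fin k) ℓ
Image P g c = ∃ λ v → P v × g v ≡ c

image? : ∀ {n k ℓ} {P : Pred (Fin n) ℓ} → Decidable P → (g : Fin n → Fin k) → Decidable (Image P g)
image? P? g c = any? (λ v → P? v ×-dec g v ≟ c)

record Collision {n k ℓ} (P : Pred (Fin n) ℓ) (g : Fin n → Fin k) : Set ℓ where
  constructor collision
  field
    u v : Fin n
    u≢v : u ≢ v
    Pu : P u
    Pv : P v
    gu≡gv : g u ≡ g v

count-image : ∀ {n k ℓ} {P : Pred (Fin n) ℓ} (P? : Decidable P) (g : Fin n → Fin k) →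
  count (does ∘ image? P? g) ≡ count (does ∘ P?) ⊎
  (count (does ∘ image? P? g) < count (does ∘ P?) × Collision P g)
count-image {zero} P? g = inj₁ (count-none (image? P? g) λ _ ())
count-image {suc n} {P = P} P? g = step (P? zero) (I′? (g zero))
  where
  I = count (does ∘ image? P? g)
  N = count (does ∘ P?)
  I′? = image? (P? ∘ suc) (g ∘ suc)
  I′ = count (does ∘ I′?)
  N′ = count (does ∘ P? ∘ suc)

  lift : Collision (P ∘ suc) (g ∘ suc) → Collision P g
  lift (collision u v u≢v Pu Pv gu≡gv) = collision (suc u) (suc v) (u≢v ∘ suc-injective) Pu Pv gu≡gv

  I′≤N′ : I′ ≤ N′
  I′≤N′ with count-image (P? ∘ suc) (g ∘ suc)
  ... | inj₁ I′≡N′ = ℕ.≤-reflexive I′≡N′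
  ... | inj₂ (I′<N′ , _) = ℕ.<⇒≤ I′<N′

  shift : ∀ d → I ≡ d + I′ → N ≡ d + N′ → I ≡ N ⊎ (I < N × Collision P g)
  shift d I≡ N≡ with count-image (P? ∘ suc) (g ∘ suc)
  ... | inj₁ I′≡N′ = inj₁ (trans I≡ (trans (cong (_+_ d) I′≡N′) (sym N≡)))
  ... | inj₂ (I′<N′ , c) = inj₂ (subst₂ _<_ (sym I≡) (sym N≡) (ℕ.+-monoʳ-< d I′<N′) , lift c)

  I≡ : ∀ {b} → does (P? zero) ≡ b → I ≡ count (λ c → (b ∧ does (g zero ≟ c)) ∨ does (I′? c))
  I≡ P0≡b = count-cong (λ c → cong (λ b → (b ∧ does (g zero ≟ c)) ∨ does (I′? c)) P0≡b)

  N≡ : ∀ {b} → does (P? zero) ≡ b → N ≡ (if b then 1 else 0) + N′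
  N≡ P0≡b = cong (λ b → (if b then 1 else 0) + N′) P0≡b

  -- Vertex zero is outside P, or repeats a value of g on the rest of P, or adds a new value.
  step : Dec (P zero) → Dec (Image (P ∘ suc) (g ∘ suc) (g zero)) →
         I ≡ N ⊎ (I < N × Collision P g)
  step (no ¬P0) _ = shift 0 (I≡ (dec-false (P? zero) ¬P0)) (N≡ (dec-false (P? zero) ¬P0))
  step (yes P0) (yes I′g0@(v , Pv , gv≡g0)) =
    inj₂ (subst₂ _<_ (sym I≡I′) (sym (N≡ (dec-true (P? zero) P0))) (s≤s I′≤N′) ,
          collision zero (suc v) (λ ()) P0 Pv (sym gv≡g0))
    where
    I≡I′ : I ≡ I′
    I≡I′ = trans (I≡ (dec-true (P? zero) P0)) (trans (count-insert (g zero) _)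
             (cong (if_then I′ else suc I′) (dec-true (I′? (g zero)) I′g0)))
  step (yes P0) (no ¬I′g0) = shift 1
    (trans (I≡ (dec-true (P? zero) P0)) (trans (count-insert (g zero) _)
      (cong (if_then I′ else suc I′) (dec-false (I′? (g zero)) ¬I′g0))))
    (N≡ (dec-true (P? zero) P0))

module _ {n k ℓ} {P : Pred (Fin n) ℓ} (P? : Decidable P) (g : Fin n → Fin k) where

  count-image-≤ : count (does ∘ image? P? g) ≤ count (does ∘ P?)
  count-image-≤ with count-image P? g
  ... | inj₁ I≡N = ℕ.≤-reflexive I≡N
  ... | inj₂ (I<N , _) = ℕ.<⇒≤ I<N

  collision-of-count-image-< : count (does ∘ image? P? g) < count (does ∘ P?) → Collision P g
  collision-of-count-image-< I<N with count-image P? g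
  ... | inj₁ I≡N = ⊥-elim (ℕ.<⇒≢ I<N I≡N)
  ... | inj₂ (_ , c) = c

  count-image-≡ : ¬ Collision P g → count (does ∘ image? P? g) ≡ count (does ∘ P?)
  count-image-≡ ¬c with count-image P? g
  ... | inj₁ I≡N = I≡N
  ... | inj₂ (_ , c) = ⊥-elim (¬c c)

_≟ₛ_ : ∀ {t} (A B : Subset t) → Dec (A ≡ B)
_≟ₛ_ = ≡-dec Bool._≟_

sumᴸ-map-0 : ∀ {A : Set} (xs : List A) → sumᴸ (map (λ _ → 0) xs) ≡ 0
sumᴸ-map-0 [] = refl
sumᴸ-map-0 (_ ∷ xs) = sumᴸ-map-0 xs

sumᴸ-map-++ : ∀ {A : Set} (h : A → ℕ) xs ys → sumᴸ (map h (xs ++ ys)) ≡ sumᴸ (map h xs) + sumᴸ (map h ys)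
sumᴸ-map-++ h xs ys = trans (cong sumᴸ (map-++ h xs ys)) (sumᴸ-++ (map h xs) (map h ys))

sumᴸ-allSubsets-suc : ∀ {t} (h : Subset (suc t) → ℕ) →
  sumᴸ (map h (allSubsets (suc t))) ≡
  sumᴸ (map (h ∘ (true ∷_)) (allSubsets t)) + sumᴸ (map (h ∘ (false ∷_)) (allSubsets t))
sumᴸ-allSubsets-suc {t} h = trans (sumᴸ-map-++ h (map (true ∷_) S) (map (false ∷_) S))
  (cong₂ _+_ (cong sumᴸ (sym (map-∘ S))) (cong sumᴸ (sym (map-∘ S))))
  where S = allSubsets t

sumᴸ-allSubsets-select : ∀ {t} (h : Subset t → ℕ) (B : Subset t) →
  sumᴸ (map (λ A → if does (B ≟ₛ A) then h A else 0) (allSubsets t)) ≡ h B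
sumᴸ-allSubsets-select {zero} h [] = ℕ.+-identityʳ (h [])
sumᴸ-allSubsets-select {suc t} h (true ∷ B) =
  trans (sumᴸ-allSubsets-suc (λ A → if does ((true ∷ B) ≟ₛ A) then h A else 0))
  (trans (cong₂ _+_ (sumᴸ-allSubsets-select (h ∘ (true ∷_)) B) (sumᴸ-map-0 (allSubsets t)))
         (ℕ.+-identityʳ _))
sumᴸ-allSubsets-select {suc t} h (false ∷ B) =
  trans (sumᴸ-allSubsets-suc (λ A → if does ((false ∷ B) ≟ₛ A) then h A else 0))
  (cong₂ _+_ (sumᴸ-map-0 (allSubsets t)) (sumᴸ-allSubsets-select (h ∘ (false ∷_)) B))

sumℤ-map-+ : ∀ {A : Set} (h : A → ℕ) (xs : List A) → sumℤ (map (+_ ∘ h) xs) ≡ + sumᴸ (map h xs)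
sumℤ-map-+ h [] = refl
sumℤ-map-+ h (a ∷ xs) = cong (ℤ._+_ (+ h a)) (sumℤ-map-+ h xs)

sumᴸ-∑-comm : ∀ {A : Set} {k} (h : A → Fin k → ℕ) (xs : List A) →
  sumᴸ (map (λ a → ∑[ c < k ] h a c) xs) ≡ ∑[ c < k ] sumᴸ (map (λ a → h a c) xs)
sumᴸ-∑-comm {k = k} h [] = sym (sum-replicate-zero k)
sumᴸ-∑-comm h (a ∷ xs) =
  trans (cong (_+_ (∑[ c < _ ] h a c)) (sumᴸ-∑-comm h xs)) (sym (∑-distrib-+ (h a) _))

if-then-count : ∀ {k} b (d : Fin k → Bool) →
  (if b then count d else 0) ≡ ∑[ c < k ] (if d c then (if b then 1 else 0) else 0)
if-then-count true d = refl
if-then-count {k} false d = sym (trans (sum-cong-≗ (λ c → if-eta (d c))) (sum-replicate-zero k))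

sumWhere-fibres : ∀ {t k} (P : Subset t → Bool) (g : Fin k → Subset t) →
  sumWhere P (λ A → + count (λ c → does (g c ≟ₛ A))) ≡ + count (P ∘ g)
sumWhere-fibres {t} {k} P g = begin
  sumℤ (map (λ A → if P A then + fibre A else 0ℤ) S)
    ≡⟨ cong sumℤ (map-cong (λ A → sym (if-float +_ (P A))) S) ⟩
  sumℤ (map (λ A → + (if P A then fibre A else 0)) S)
    ≡⟨ sumℤ-map-+ (λ A → if P A then fibre A else 0) S ⟩
  + sumᴸ (map (λ A → if P A then fibre A else 0) S)
    ≡⟨ cong (+_ ∘ sumᴸ) (map-cong (λ A → if-then-count (P A) (λ c → does (g c ≟ₛ A))) S) ⟩
  + sumᴸ (map (λ A → ∑[ c < k ] (if does (g c ≟ₛ A) then (if P A then 1 else 0) else 0)) S)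
    ≡⟨ cong +_ (sumᴸ-∑-comm (λ A c → if does (g c ≟ₛ A) then (if P A then 1 else 0) else 0) S) ⟩
  + ∑[ c < k ] sumᴸ (map (λ A → if does (g c ≟ₛ A) then (if P A then 1 else 0) else 0) S)
    ≡⟨ cong +_ (sum-cong-≗ (λ c → sumᴸ-allSubsets-select (λ A → if P A then 1 else 0) (g c))) ⟩
  + count (P ∘ g) ∎
  where
  open ≡-Reasoning
  S = allSubsets t
  fibre : Subset t → ℕ
  fibre A = count (λ c → does (g c ≟ₛ A))

distinct-abab : ∀ {k} (a b : Fin k) → length (deduplicate _≟_ (a ∷ b ∷ a ∷ b ∷ [])) ≤ 2
distinct-abab a b with a ≟ b
... | yes refl rewrite ≡-≟-identity _≟_ (refl {x = a}) = s≤s z≤n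
... | no a≢b rewrite dec-no (b ≟ a) (a≢b ∘ sym) | ≡-≟-identity _≟_ (refl {x = a})
                   | ≡-≟-identity _≟_ (refl {x = b}) = s≤s (s≤s z≤n)

module _ {n k} {E : Adjacency n} {f : Fin n → Fin k} (star : IsStarColouring E f) where

  star-no-bichromatic-P4 : ∀ {a b c d} → IsP4 E a b c d → f a ≡ f c → f b ≡ f d → ⊥
  star-no-bichromatic-P4 {a} {b} {c} {d} abcd fa≡fc fb≡fd =
    ℕ.≤⇒≯ (distinct-abab (f a) (f b))
      (subst (λ l → 3 ≤ length (deduplicate _≟_ l))
             (cong₂ (λ x y → f a ∷ f b ∷ x ∷ y ∷ []) (sym fa≡fc) (sym fb≡fd))
             (proj₂ star a b c d abcd))

module Construction {n t k} (E : Adjacency n) (τ : Fin n → Fin t) (cl : Fin t → Bool)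
  (simple : IsSimpleGraph E) (partition : IsTypePartition E τ cl)
  (f : Fin n → Fin k) (star : IsStarColouring E f) where

  InType : Fin t → Pred (Fin n) 0ℓ
  InType i v = τ v ≡ i

  inType? : ∀ i → Decidable (InType i)
  inType? i v = τ v ≟ i

  Occurs : Fin t → Pred (Fin k) 0ℓ
  Occurs i = Image (InType i) f

  occurs? : ∀ i → Decidable (Occurs i)
  occurs? i = image? (inType? i) f

  Clash : Fin t → Set
  Clash i = Collision (InType i) f

  support : Fin k → Subset t
  support c = Vec.tabulate (λ i → does (occurs? i c))

  lookup-support : ∀ c i → lookup (support c) i ≡ does (occurs? i c)
  lookup-support c i = lookup∘tabulate (λ j → does (occurs? j c)) i

  colourCount : Subset t → ℤ
  colourCount A = + count (λ c → does (support c ≟ₛ A))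

  coloursOn : Fin t → ℕ
  coloursOn i = count (does ∘ occurs? i)

  sum∋-colourCount : ∀ i → sum∋ i colourCount ≡ + coloursOn i
  sum∋-colourCount i = trans (sumWhere-fibres (λ A → lookup A i) support)
    (cong +_ (count-cong (λ c → lookup-support c i)))

  sum∋₂-colourCount : ∀ i j →
    sum∋₂ i j colourCount ≡ + count (λ c → does (occurs? i c ×-dec occurs? j c))
  sum∋₂-colourCount i j = trans (sumWhere-fibres (λ A → lookup A i ∧ lookup A j) support)
    (cong +_ (count-cong (λ c → cong₂ _∧_ (lookup-support c i) (lookup-support c j))))

  sumAll-colourCount : sumAll colourCount ≡ + k
  sumAll-colourCount = trans (sumWhere-fibres (λ _ → true) support) (cong +_ (count-all-true k))

  card≡count : ∀ i → card τ i ≡ count (does ∘ inType? i)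
  card≡count i = length-filter-tabulate (inType? i) (λ v → v)

  occurs-of-support : ∀ {c A i} → support c ≡ A → lookup A i ≡ true → Occurs i c
  occurs-of-support {c} {A} {i} support≡A A∋i = from-does (occurs? i c)
    (trans (sym (lookup-support c i)) (trans (cong (λ B → lookup B i) support≡A) A∋i))

  shared-colour : ∀ {i j} → + 1 ℤ.≤ sum∋₂ i j colourCount → ∃ λ c → Occurs i c × Occurs j c
  shared-colour {i} {j} 1≤sum = count-witness (λ c → occurs? i c ×-dec occurs? j c)
    (drop‿+≤+ (subst (+ 1 ℤ.≤_) (sum∋₂-colourCount i j) 1≤sum))

  sum∋₂≡0 : ∀ {i j} → (∀ {c} → Occurs i c → Occurs j c → ⊥) → sum∋₂ i j colourCount ≡ 0ℤ
  sum∋₂≡0 {i} {j} disjoint = trans (sum∋₂-colourCount i j)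
    (cong +_ (count-none (λ c → occurs? i c ×-dec occurs? j c) (λ c (oi , oj) → disjoint oi oj)))

  clash-of-< : ∀ {i} → sum∋ i colourCount ℤ.< + card τ i → Clash i
  clash-of-< {i} sum<card = collision-of-count-image-< (inType? i) f
    (subst (coloursOn i <_) (card≡count i)
      (drop‿+<+ (subst (ℤ._< + card τ i) (sum∋-colourCount i) sum<card)))

  sum∋≡card : ∀ {i} → ¬ Clash i → sum∋ i colourCount ≡ + card τ i
  sum∋≡card {i} ¬clash = trans (sum∋-colourCount i)
    (cong +_ (trans (count-image-≡ (inType? i) f ¬clash) (sym (card≡count i))))

  edge : ∀ {i j u v} → TAdj E τ i j → τ u ≡ i → τ v ≡ j → E u v ≡ true
  edge (_ , adjacent) τu τv = adjacent _ _ τu τv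

  TAdj-sym : ∀ {i j} → TAdj E τ i j → TAdj E τ j i
  TAdj-sym (i≢j , adjacent) =
    (i≢j ∘ sym) , λ u v τu τv → trans (proj₁ simple u v) (adjacent v u τv τu)

  ≢-of-types : ∀ {i j u v} → τ u ≡ i → τ v ≡ j → i ≢ j → u ≢ v
  ≢-of-types τu τv i≢j refl = i≢j (trans (sym τu) τv)

  adjacent-types-share-no-colour : ∀ {i j c} → TAdj E τ i j → Occurs i c → Occurs j c → ⊥
  adjacent-types-share-no-colour ij (u , τu , fu) (v , τv , fv) =
    proj₁ star u v (edge ij τu τv) (trans fu (sym fv))

  clique-no-clash : ∀ {i} → cl i ≡ true → ¬ Clash i
  clique-no-clash cli (collision u v u≢v τu τv fu≡fv) =
    proj₁ star u v (trans (proj₂ (proj₂ partition) u v (trans τu (sym τv)) u≢v) (trans (cong cl τu) cli)) fu≡fv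

  colour-on-every-type : ∀ i → 1 ≤ coloursOn i
  colour-on-every-type i with count-witness (inType? i) (subst (1 ≤_) (card≡count i) (proj₁ partition i))
  ... | v , τv = count-some (occurs? i) (v , τv , refl)

  coloursOn-≤-card : ∀ i → coloursOn i ≤ card τ i
  coloursOn-≤-card i = subst (coloursOn i ≤_) (sym (card≡count i)) (count-image-≤ (inType? i) f)

  path-types-no-alternating-colours : ∀ {i₁ i₂ i₃ i₄ c d} →
    i₁ ≢ i₃ → i₁ ≢ i₄ → i₂ ≢ i₄ →
    TAdj E τ i₂ i₁ → TAdj E τ i₂ i₃ → TAdj E τ i₃ i₄ →
    Occurs i₁ c → Occurs i₃ c → Occurs i₂ d → Occurs i₄ d → ⊥
  path-types-no-alternating-colours i₁≢i₃ i₁≢i₄ i₂≢i₄ t₂₁ t₂₃ t₃₄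
    (u₁ , τu₁ , fu₁) (u₃ , τu₃ , fu₃) (u₂ , τu₂ , fu₂) (u₄ , τu₄ , fu₄) =
    star-no-bichromatic-P4 star
      ( ≢-of-types τu₁ τu₂ (proj₁ (TAdj-sym t₂₁)) , ≢-of-types τu₁ τu₃ i₁≢i₃ , ≢-of-types τu₁ τu₄ i₁≢i₄
      , ≢-of-types τu₂ τu₃ (proj₁ t₂₃) , ≢-of-types τu₂ τu₄ i₂≢i₄ , ≢-of-types τu₃ τu₄ (proj₁ t₃₄)
      , edge (TAdj-sym t₂₁) τu₁ τu₂ , edge t₂₃ τu₂ τu₃ , edge t₃₄ τu₃ τu₄ )
      (trans fu₁ (sym fu₃)) (trans fu₂ (sym fu₄))

  clash-no-shared-neighbour-colour : ∀ {i₁ i₂ i₃ d} → i₂ ≢ i₃ →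
    TAdj E τ i₁ i₂ → TAdj E τ i₁ i₃ → Clash i₁ → Occurs i₂ d → Occurs i₃ d → ⊥
  clash-no-shared-neighbour-colour i₂≢i₃ t₁₂ t₁₃
    (collision u u′ u≢u′ τu τu′ fu≡fu′) (v₂ , τv₂ , fv₂) (v₃ , τv₃ , fv₃) =
    star-no-bichromatic-P4 star
      ( ≢-of-types τu τv₂ (proj₁ t₁₂) , u≢u′ , ≢-of-types τu τv₃ (proj₁ t₁₃)
      , ≢-of-types τv₂ τu′ (proj₁ (TAdj-sym t₁₂)) , ≢-of-types τv₂ τv₃ i₂≢i₃ , ≢-of-types τu′ τv₃ (proj₁ t₁₃)
      , edge t₁₂ τu τv₂ , edge (TAdj-sym t₁₂) τv₂ τu′ , edge t₁₃ τu′ τv₃ )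
      fu≡fu′ (trans fv₂ (sym fv₃))

  adjacent-types-not-both-clash : ∀ {i j} → TAdj E τ i j → Clash i → Clash j → ⊥
  adjacent-types-not-both-clash tᵢⱼ
    (collision u u′ u≢u′ τu τu′ fu≡fu′) (collision w w′ w≢w′ τw τw′ fw≡fw′) =
    star-no-bichromatic-P4 star
      ( ≢-of-types τu τw i≢j , u≢u′ , ≢-of-types τu τw′ i≢j
      , ≢-of-types τw τu′ (i≢j ∘ sym) , w≢w′ , ≢-of-types τu′ τw′ i≢j
      , edge tᵢⱼ τu τw , edge (TAdj-sym tᵢⱼ) τw τu′ , edge tᵢⱼ τu′ τw′ )
      fu≡fu′ fw≡fw′
    where i≢j = proj₁ tᵢⱼ

  feasible : Feasible E τ cl k colourCount
  feasible =
    ( λ A i j tᵢⱼ A∋i A∋j → cong +_ (count-none (λ c → support c ≟ₛ A)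
        (λ c support≡A → adjacent-types-share-no-colour tᵢⱼ
          (occurs-of-support support≡A A∋i) (occurs-of-support support≡A A∋j))) )
    , ≤-reflexive sumAll-colourCount
    , (λ i cli → sum∋≡card (clique-no-clash cli))
    , (λ i _ → subst (λ s → + 1 ℤ.≤ s × s ℤ.≤ + (k ⊓ card τ i)) (sym (sum∋-colourCount i))
        (ℤ.+≤+ (colour-on-every-type i) , ℤ.+≤+ (ℕ.⊓-glb (count-≤ _) (coloursOn-≤-card i))))
    , (λ i₁ i₂ i₃ i₄ _ i₁≢i₃ i₁≢i₄ _ i₂≢i₄ _ t₂₁ t₂₃ t₃₄ 1≤sum →
        let (_ , c∈i₁ , c∈i₃) = shared-colour 1≤sum in
        sum∋₂≡0 (path-types-no-alternating-colours i₁≢i₃ i₁≢i₄ i₂≢i₄ t₂₁ t₂₃ t₃₄ c∈i₁ c∈i₃))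
    , (λ i₁ i₂ i₃ _ _ i₂≢i₃ _ t₁₂ t₁₃ sum<card →
        sum∋₂≡0 (clash-no-shared-neighbour-colour i₂≢i₃ t₁₂ t₁₃ (clash-of-< sum<card)))
    , (λ i₁ i₂ _ _ _ t₂₁ →
        (λ sum₁<card → sum∋≡card (λ clash₂ → adjacent-types-not-both-clash t₂₁ clash₂ (clash-of-< sum₁<card)))
      , (λ sum₂<card → sum∋≡card (λ clash₁ → adjacent-types-not-both-clash t₂₁ (clash-of-< sum₂<card) clash₁)))
    , (λ A → ℤ.+≤+ z≤n)

lemma2 : (n t k : ℕ) (E : Adjacency n) (τ : Fin n → Fin t) (cl : Fin t → Bool) →
    IsSimpleGraph E → 1 ≤ k → IsTypePartition E τ cl →
    Σ (Fin n → Fin k) (λ f → IsStarColouring E f) →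
    Σ (Subset t → ℤ) (λ x → Feasible E τ cl k x)
lemma2 n t k E τ cl simple _ partition (f , star) = colourCount , feasible
  where open Construction E τ cl simple partition f star
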